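{- Let $G$ be a graph and let $\mathcal{H}=\{H_v\colon v\in V(G)\}$ be a family of nonempty graphs indexed by the vertices of $G$. Then the corona $G\circ\mathcal{H}$ is $\alpha$-excellent if and only if every graph in $\mathcal{H}$ is complete. In particular, $G\circ K_1$ is $\alpha$-excellent for every graph $G$.
   Context: All graphs are finite and simple. An $\alpha$-set of a graph is a maximum independent set; a graph is $\alpha$-excellent if every vertex lies in some $\alpha$-set. The corona $G\circ\mathcal{H}$ is the disjoint union of $G$ and the graphs $H_v$ ($v\in V(G)$), together with edges joining each vertex $v$ of $G$ to all vertices of $H_v$; $G\circ K_1$ is the case where every $H_v$ is $K_1$. -}

module Defs where

open import Data.Nat using (ℕ; zero; suc; _+_; _≤_)
open import Data.Bool using (Bool; true; false; _∧_)
open import Data.Fin using (Fin; zero; suc; splitAt; _≟_)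
open import Data.Fin.Subset using (Subset; _∈_; ∣_∣)
open import Data.Sum using (_⊎_; inj₁; inj₂)
open import Data.Product using (Σ; _×_; _,_; proj₁; proj₂; ∃)
open import Function using (_∘_)
open import Relation.Nullary using (¬_)
open import Relation.Nullary.Decidable using (⌊_⌋)
open import Relation.Binary.PropositionalEquality using (_≡_; refl)

record RawGraph : Set where
  field
    n      : ℕ
    adj    : Fin n → Fin n → Bool
open RawGraph public

record Graph : Set where
  field
    raw        : RawGraph
    adj-sym    : ∀ i j → adj raw i j ≡ adj raw j i
    adj-irrefl : ∀ i → adj raw i i ≡ false
open Graph public using (raw)

Independent : (G : RawGraph) → Subset (n G) → Set
Independent G S = ∀ i j → i ∈ S → j ∈ S → adj G i j ≡ false

IsαSet : (G : RawGraph) → Subset (n G) → Set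
IsαSet G S = Independent G S × (∀ T → Independent G T → ∣ T ∣ ≤ ∣ S ∣)

αExcellent : RawGraph → Set
αExcellent G = ∀ v → ∃ λ S → IsαSet G S × v ∈ S

Complete : RawGraph → Set
Complete G = ∀ i j → ¬ (i ≡ j) → adj G i j ≡ true

Nonempty : RawGraph → Set
Nonempty G = 1 ≤ n G

K₁ : Graph
K₁ = record { raw = record { n = 1 ; adj = λ _ _ → false } ; adj-sym = λ _ _ → refl ; adj-irrefl = λ _ → refl }

-- Finite sum of sizes, and the canonical decoding of Fin (total n m)
-- as the disjoint union Σ (v : Fin n) Fin (m v) (a bijection).
total : ∀ n → (Fin n → ℕ) → ℕ
total zero    m = 0
total (suc n) m = m zero + total n (m ∘ suc)

decode : ∀ n (m : Fin n → ℕ) → Fin (total n m) → Σ (Fin n) (λ v → Fin (m v))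
decode (suc n) m i with splitAt (m zero) i
... | inj₁ a = zero , a
... | inj₂ b with decode n (m ∘ suc) b
...   | v , c = suc v , c

eqF : ∀ {k} → Fin k → Fin k → Bool
eqF i j = ⌊ i ≟ j ⌋

-- Adjacency of the corona: vertex set Fin (n + total), first n vertices are G,
-- the rest (decoded) are pairs (v , x) with x a vertex of H v.
coronaAdj : (G : RawGraph) (H : Fin (n G) → RawGraph) →
            Fin (n G + total (n G) (n ∘ H)) → Fin (n G + total (n G) (n ∘ H)) → Bool
coronaAdj G H x y with splitAt (n G) x | splitAt (n G) y
... | inj₁ u | inj₁ w = adj G u w
... | inj₁ u | inj₂ q = eqF u (proj₁ (decode (n G) (n ∘ H) q))
... | inj₂ p | inj₁ w = eqF w (proj₁ (decode (n G) (n ∘ H) p))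
... | inj₂ p | inj₂ q = helper (decode (n G) (n ∘ H) p) (decode (n G) (n ∘ H) q)
  where
  helper : Σ (Fin (n G)) (λ v → Fin (n (H v))) → Σ (Fin (n G)) (λ v → Fin (n (H v))) → Bool
  helper (v , a) (w , b) with v ≟ w
  ... | Relation.Nullary.yes refl = adj (H v) a b
  ... | Relation.Nullary.no _ = false

-- The corona G ∘ H (as a raw graph; it is simple whenever G and all H v are).
corona : (G : Graph) → (Fin (n (raw G)) → Graph) → RawGraph
corona G H = record { n = n (raw G) + total (n (raw G)) (λ v → n (raw (H v)))
                    ; adj = coronaAdj (raw G) (raw ∘ H) }

-- The fiber of a vertex v of G consists of v and its copy of H v. If H v has two
-- nonadjacent vertices a and b, an α-set through v avoids H v, and exchanging v for
-- a and b gives a larger independent set. If every H v is complete, every fiber is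
-- a clique, so independent sets have at most ∣V(G)∣ vertices; and any vertex x lies
-- in the independent transversal that takes x in its own fiber and an arbitrary
-- vertex of H w in every other fiber w.
module Submission where

open import Data.Bool using (Bool; true; false)
open import Data.Fin using (Fin; zero; suc; splitAt; _≟_; _↑ˡ_; _↑ʳ_; fromℕ<)
open import Data.Fin.Properties using (splitAt-↑ˡ; splitAt-↑ʳ; splitAt⁻¹-↑ˡ; splitAt⁻¹-↑ʳ; suc-injective; ↑ʳ-injective)
open import Data.Fin.Subset using (Subset; _∈_; _∉_; ∣_∣; ⊤; _∪_; _-_; ⁅_⁆; inside; outside)
open import Data.Fin.Subset.Properties using (∣⊤∣≡n; ∈⊤; x∈p∧x≢y⇒x∈p-y; x∈p⇒∣p-x∣<∣p∣; x∈⁅x⁆; x∈⁅y⁆⇒x≡y; x∈p∪q⁺; x∈p∪q⁻; p─q⊆p)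
open import Data.Nat using (ℕ; zero; suc; _≤_; _<_; z≤n; s≤s)
open import Data.Nat.Properties using (≤-trans; ≤-reflexive; ≤-<-trans; <⇒≱)
open import Data.Product using (Σ; _×_; _,_; proj₁; proj₂)
open import Data.Sum using (_⊎_; inj₁; inj₂; [_,_]′)
open import Data.Vec using (_∷_; []; tabulate; here; there)
open import Data.Vec.Properties using (lookup∘tabulate; []=⇒lookup; lookup⇒[]=)
open import Function using (_∘_; id; case_of_)
open import Function.Bundles using (_⇔_; mk⇔; module Equivalence)
open import Relation.Binary.PropositionalEquality using (_≡_; _≢_; refl; sym; trans; cong; subst; subst₂; ≢-sym)
open import Relation.Nullary using (yes; no; does; contradiction)
open import Relation.Nullary.Decidable using (dec-true; dec-false; isYes≗does)
open import Relation.Unary using (Pred; Decidable)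

open import Defs

encode : ∀ n (m : Fin n → ℕ) → Σ (Fin n) (λ v → Fin (m v)) → Fin (total n m)
encode (suc n) m (zero  , a) = a ↑ˡ total n (m ∘ suc)
encode (suc n) m (suc v , a) = m zero ↑ʳ encode n (m ∘ suc) (v , a)

decode∘encode : ∀ n m p → decode n m (encode n m p) ≡ p
decode∘encode (suc n) m (zero , a)
  rewrite splitAt-↑ˡ (m zero) a (total n (m ∘ suc)) = refl
decode∘encode (suc n) m (suc v , a)
  rewrite splitAt-↑ʳ (m zero) (total n (m ∘ suc)) (encode n (m ∘ suc) (v , a))
        | decode∘encode n (m ∘ suc) (v , a) = refl

encode∘decode : ∀ n m i → encode n m (decode n m i) ≡ i
encode∘decode (suc n) m i with splitAt (m zero) i in eq
... | inj₁ a = splitAt⁻¹-↑ˡ eq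
... | inj₂ b = trans (cong (m zero ↑ʳ_) (encode∘decode n (m ∘ suc) b)) (splitAt⁻¹-↑ʳ eq)

fromDec : ∀ {k ℓ} {P : Pred (Fin k) ℓ} → Decidable P → Subset k
fromDec P? = tabulate (does ∘ P?)

module _ {k ℓ} {P : Pred (Fin k) ℓ} (P? : Decidable P) where
  ∈fromDec⁺ : ∀ {x} → P x → x ∈ fromDec P?
  ∈fromDec⁺ {x} px = lookup⇒[]= x _ (trans (lookup∘tabulate (does ∘ P?) x) (dec-true (P? x) px))

  ∈fromDec⁻ : ∀ {x} → x ∈ fromDec P? → P x
  ∈fromDec⁻ {x} x∈ with P? x | trans (sym (lookup∘tabulate (does ∘ P?) x)) ([]=⇒lookup x∈)
  ... | yes px | _ = px
  ... | no _   | ()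

x∈p-y⇒x≢y : ∀ {k} {p : Subset k} {x y : Fin k} → x ∈ p - y → x ≢ y
x∈p-y⇒x≢y {p = _ ∷ _} {zero}  ()         refl
x∈p-y⇒x≢y {p = _ ∷ p} {suc x} (there x∈) refl = x∈p-y⇒x≢y {p = p} x∈ refl

injection⇒∣p∣≤∣q∣ : ∀ {k l} {p : Subset k} {q : Subset l} (f : Fin k → Fin l) →
                    (∀ {x} → x ∈ p → f x ∈ q) →
                    (∀ {x y} → x ∈ p → y ∈ p → f x ≡ f y → x ≡ y) →
                    ∣ p ∣ ≤ ∣ q ∣
injection⇒∣p∣≤∣q∣ {p = []} f _ _ = z≤n
injection⇒∣p∣≤∣q∣ {p = outside ∷ p} f into inj =
  injection⇒∣p∣≤∣q∣ (f ∘ suc) (into ∘ there) (λ x∈ y∈ → suc-injective ∘ inj (there x∈) (there y∈))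
injection⇒∣p∣≤∣q∣ {p = inside ∷ p} {q} f into inj =
  ≤-trans (s≤s (injection⇒∣p∣≤∣q∣ (f ∘ suc) into-q-f0 (λ x∈ y∈ → suc-injective ∘ inj (there x∈) (there y∈))))
          (x∈p⇒∣p-x∣<∣p∣ (into here))
  where
  into-q-f0 : ∀ {x} → x ∈ p → f (suc x) ∈ q - f zero
  into-q-f0 x∈ = x∈p∧x≢y⇒x∈p-y (into (there x∈)) (λ e → case inj (there x∈) here e of λ ())

∣independent∣≤cliqueCover : (G : RawGraph) {k : ℕ} (c : Fin (n G) → Fin k) →
                            (∀ x y → c x ≡ c y → x ≢ y → adj G x y ≡ true) →
                            ∀ {S} → Independent G S → ∣ S ∣ ≤ k
∣independent∣≤cliqueCover G {k} c clique {S} indep =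
  ≤-trans (injection⇒∣p∣≤∣q∣ c (λ _ → ∈⊤) c-injective) (≤-reflexive (∣⊤∣≡n k))
  where
  c-injective : ∀ {x y} → x ∈ S → y ∈ S → c x ≡ c y → x ≡ y
  c-injective {x} {y} x∈S y∈S cx≡cy with x ≟ y
  ... | yes x≡y = x≡y
  ... | no  x≢y = contradiction (trans (sym (clique x y cx≡cy x≢y)) (indep x y x∈S y∈S)) λ ()

eqF-≡ : ∀ {k} {i j : Fin k} → i ≡ j → eqF i j ≡ true
eqF-≡ {i = i} {j} i≡j = trans (isYes≗does (i ≟ j)) (dec-true (i ≟ j) i≡j)

eqF-≢ : ∀ {k} {i j : Fin k} → i ≢ j → eqF i j ≡ false
eqF-≢ {i = i} {j} i≢j = trans (isYes≗does (i ≟ j)) (dec-false (i ≟ j) i≢j)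

module Corona (G : Graph) (H : Fin (n (raw G)) → Graph) where

  N : ℕ
  N = n (raw G)

  m : Fin N → ℕ
  m v = n (raw (H v))

  Vertex : Set
  Vertex = Fin (n (corona G H))

  _~_ : Vertex → Vertex → Bool
  _~_ = adj (corona G H)

  base : Fin N → Vertex
  base u = u ↑ˡ total N m

  leaf : (v : Fin N) → Fin (m v) → Vertex
  leaf v a = N ↑ʳ encode N m (v , a)

  data View : Vertex → Set where
    isBase : ∀ u → View (base u)
    isLeaf : ∀ v a → View (leaf v a)

  view : ∀ x → View x
  view x with splitAt N x in eq
  ... | inj₁ u = subst View (splitAt⁻¹-↑ˡ eq) (isBase u)
  ... | inj₂ p = subst View (trans (cong (N ↑ʳ_) (encode∘decode N m p)) (splitAt⁻¹-↑ʳ eq))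
                          (isLeaf (proj₁ (decode N m p)) (proj₂ (decode N m p)))

  fiber : Vertex → Fin N
  fiber x = [ id , proj₁ ∘ decode N m ]′ (splitAt N x)

  fiber-base : ∀ u → fiber (base u) ≡ u
  fiber-base u = cong [ id , proj₁ ∘ decode N m ]′ (splitAt-↑ˡ N u (total N m))

  fiber-leaf : ∀ v a → fiber (leaf v a) ≡ v
  fiber-leaf v a rewrite splitAt-↑ʳ N (total N m) (encode N m (v , a))
                       | decode∘encode N m (v , a) = refl

  leaf-injective : ∀ v {a b} → leaf v a ≡ leaf v b → a ≡ b
  leaf-injective v {a} {b} eq = proj₂-≡ (trans (sym (decode∘encode N m (v , a)))
    (trans (cong (decode N m) (↑ʳ-injective N _ _ eq)) (decode∘encode N m (v , b))))
    where
    proj₂-≡ : {x y : Fin (m v)} → _≡_ {A = Σ (Fin N) (Fin ∘ m)} (v , x) (v , y) → x ≡ y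
    proj₂-≡ refl = refl

  adj-base-base : ∀ u w → base u ~ base w ≡ adj (raw G) u w
  adj-base-base u w rewrite splitAt-↑ˡ N u (total N m) | splitAt-↑ˡ N w (total N m) = refl

  adj-base-leaf : ∀ u w b → base u ~ leaf w b ≡ eqF u w
  adj-base-leaf u w b rewrite splitAt-↑ˡ N u (total N m)
                            | splitAt-↑ʳ N (total N m) (encode N m (w , b))
                            | decode∘encode N m (w , b) = refl

  adj-leaf-base : ∀ v a w → leaf v a ~ base w ≡ eqF w v
  adj-leaf-base v a w rewrite splitAt-↑ʳ N (total N m) (encode N m (v , a))
                            | splitAt-↑ˡ N w (total N m)
                            | decode∘encode N m (v , a) = refl

  adj-leaf-leaf : ∀ v a b → leaf v a ~ leaf v b ≡ adj (raw (H v)) a b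
  adj-leaf-leaf v a b rewrite splitAt-↑ʳ N (total N m) (encode N m (v , a))
                            | splitAt-↑ʳ N (total N m) (encode N m (v , b))
                            | decode∘encode N m (v , a)
                            | decode∘encode N m (v , b)
                            with v ≟ v
  ... | yes refl = refl
  ... | no  v≢v  = contradiction refl v≢v

  adj-leaf-leaf-≢ : ∀ {v w} a b → v ≢ w → leaf v a ~ leaf w b ≡ false
  adj-leaf-leaf-≢ {v} {w} a b v≢w rewrite splitAt-↑ʳ N (total N m) (encode N m (v , a))
                                        | splitAt-↑ʳ N (total N m) (encode N m (w , b))
                                        | decode∘encode N m (v , a)
                                        | decode∘encode N m (w , b)
                                        with v ≟ w
  ... | yes v≡w = contradiction v≡w v≢w
  ... | no  _   = refl

  IsLeaf : Vertex → Set
  IsLeaf x = Σ (Fin N) λ v → Σ (Fin (m v)) λ a → x ≡ leaf v a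

  ~-irrefl : ∀ x → x ~ x ≡ false
  ~-irrefl x with view x
  ... | isBase u   = trans (adj-base-base u u) (Graph.adj-irrefl G u)
  ... | isLeaf v a = trans (adj-leaf-leaf v a a) (Graph.adj-irrefl (H v) a)

  base~leaf : ∀ v a → base v ~ leaf v a ≡ true
  base~leaf v a = trans (adj-base-leaf v v a) (eqF-≡ refl)

  adj-crossFiber : ∀ {x y} → fiber x ≢ fiber y → IsLeaf x ⊎ IsLeaf y → x ~ y ≡ false
  adj-crossFiber {y = y} fibers≢ (inj₁ (v , a , refl)) with view y
  ... | isBase w   = trans (adj-leaf-base v a w)
                           (eqF-≢ (≢-sym (subst₂ _≢_ (fiber-leaf v a) (fiber-base w) fibers≢)))
  ... | isLeaf w b = adj-leaf-leaf-≢ a b (subst₂ _≢_ (fiber-leaf v a) (fiber-leaf w b) fibers≢)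
  adj-crossFiber {x = x} fibers≢ (inj₂ (w , b , refl)) with view x
  ... | isBase u   = trans (adj-base-leaf u w b)
                           (eqF-≢ (subst₂ _≢_ (fiber-base u) (fiber-leaf w b) fibers≢))
  ... | isLeaf v a = adj-leaf-leaf-≢ a b (subst₂ _≢_ (fiber-leaf v a) (fiber-leaf w b) fibers≢)

  adj-sameFiber : (∀ v → Complete (raw (H v))) →
                  ∀ x y → fiber x ≡ fiber y → x ≢ y → x ~ y ≡ true
  adj-sameFiber complete x y same x≢y with view x | view y
  ... | isBase u   | isBase w   = contradiction (cong base (subst₂ _≡_ (fiber-base u) (fiber-base w) same)) x≢y
  ... | isBase u   | isLeaf w b =
    trans (adj-base-leaf u w b) (eqF-≡ (subst₂ _≡_ (fiber-base u) (fiber-leaf w b) same))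
  ... | isLeaf v a | isBase w   =
    trans (adj-leaf-base v a w) (eqF-≡ (subst₂ _≡_ (fiber-base w) (fiber-leaf v a) (sym same)))
  ... | isLeaf v a | isLeaf w b with subst₂ _≡_ (fiber-leaf v a) (fiber-leaf w b) same
  ...   | refl = trans (adj-leaf-leaf v a b) (complete v a b (x≢y ∘ cong (leaf v)))

  ∣independent∣≤N : (∀ v → Complete (raw (H v))) →
                    ∀ {S} → Independent (corona G H) S → ∣ S ∣ ≤ N
  ∣independent∣≤N complete = ∣independent∣≤cliqueCover (corona G H) fiber (adj-sameFiber complete)

  picked? : (pick : Fin N → Vertex) → Decidable (λ y → pick (fiber y) ≡ y)
  picked? pick y = pick (fiber y) ≟ y

  -- The image of pick, when pick is a section of fiber.
  transversal : (Fin N → Vertex) → Subset (n (corona G H))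
  transversal pick = fromDec (picked? pick)

  module Transversal (pick : Fin N → Vertex) (fiber∘pick : ∀ w → fiber (pick w) ≡ w) where

    pick∈transversal : ∀ w → pick w ∈ transversal pick
    pick∈transversal w = ∈fromDec⁺ (picked? pick) (cong pick (fiber∘pick w))

    N≤∣transversal∣ : N ≤ ∣ transversal pick ∣
    N≤∣transversal∣ = ≤-trans (≤-reflexive (sym (∣⊤∣≡n N)))
      (injection⇒∣p∣≤∣q∣ {p = ⊤} pick (λ {w} _ → pick∈transversal w)
        (λ {v} {w} _ _ pv≡pw → trans (sym (fiber∘pick v)) (trans (cong fiber pv≡pw) (fiber∘pick w))))

    transversal-independent : ∀ u → (∀ w → w ≢ u → IsLeaf (pick w)) →
                              Independent (corona G H) (transversal pick)
    transversal-independent u leafElsewhere y z y∈ z∈ =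
      picked (∈fromDec⁻ (picked? pick) y∈) (∈fromDec⁻ (picked? pick) z∈)
      where
      picked : pick (fiber y) ≡ y → pick (fiber z) ≡ z → y ~ z ≡ false
      picked y≡ z≡ with fiber y ≟ fiber z | fiber y ≟ u
      ... | yes same | _ = subst (λ z → y ~ z ≡ false) (trans (sym y≡) (trans (cong pick same) z≡)) (~-irrefl y)
      ... | no differ | no fy≢u = adj-crossFiber differ (inj₁ (subst IsLeaf y≡ (leafElsewhere _ fy≢u)))
      ... | no differ | yes fy≡u =
        adj-crossFiber differ (inj₂ (subst IsLeaf z≡ (leafElsewhere _ (λ fz≡u → differ (trans fy≡u (sym fz≡u))))))

  complete⇒αExcellent : (∀ v → Nonempty (raw (H v))) → (∀ v → Complete (raw (H v))) →
                        αExcellent (corona G H)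
  complete⇒αExcellent nonempty complete x =
    transversal pick , (transversal-independent (fiber x) leafElsewhere , maximum) , x∈transversal
    where
    pick : Fin N → Vertex
    pick w with w ≟ fiber x
    ... | yes _ = x
    ... | no  _ = leaf w (fromℕ< (nonempty w))

    fiber∘pick : ∀ w → fiber (pick w) ≡ w
    fiber∘pick w with w ≟ fiber x
    ... | yes w≡ = sym w≡
    ... | no  _  = fiber-leaf w _

    leafElsewhere : ∀ w → w ≢ fiber x → IsLeaf (pick w)
    leafElsewhere w w≢ with w ≟ fiber x
    ... | yes w≡ = contradiction w≡ w≢
    ... | no  _  = w , _ , refl

    open Transversal pick fiber∘pick

    maximum : ∀ T → Independent (corona G H) T → ∣ T ∣ ≤ ∣ transversal pick ∣
    maximum T indep = ≤-trans (∣independent∣≤N complete indep) N≤∣transversal∣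

    x∈transversal : x ∈ transversal pick
    x∈transversal = subst (_∈ transversal pick) picked (pick∈transversal (fiber x))
      where
      picked : pick (fiber x) ≡ x
      picked with fiber x ≟ fiber x
      ... | yes _ = refl
      ... | no ≢x = contradiction refl ≢x

  module Exchange {S} (indep : Independent (corona G H) S) {v} (base∈S : base v ∈ S)
                  {a b : Fin (m v)} (a≢b : a ≢ b) (a≁b : adj (raw (H v)) a b ≡ false) where

    T : Subset (n (corona G H))
    T = (S - base v) ∪ (⁅ leaf v a ⁆ ∪ ⁅ leaf v b ⁆)

    leaf∉S : ∀ c → leaf v c ∉ S
    leaf∉S c leaf∈S = contradiction (trans (sym (base~leaf v c)) (indep _ _ base∈S leaf∈S)) λ ()

    fiber≢v : ∀ {z} → z ∈ S → z ≢ base v → fiber z ≢ v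
    fiber≢v {z} z∈S z≢ with view z
    ... | isBase w   = z≢ ∘ cong base ∘ trans (sym (fiber-base w))
    ... | isLeaf w c = λ fz≡v → case trans (sym (fiber-leaf w c)) fz≡v of λ { refl → leaf∉S c z∈S }

    Newcomer : Fin (m v) → Set
    Newcomer c = c ≡ a ⊎ c ≡ b

    newcomers-nonadjacent : ∀ {c d} → Newcomer c → Newcomer d → adj (raw (H v)) c d ≡ false
    newcomers-nonadjacent (inj₁ refl) (inj₁ refl) = Graph.adj-irrefl (H v) a
    newcomers-nonadjacent (inj₁ refl) (inj₂ refl) = a≁b
    newcomers-nonadjacent (inj₂ refl) (inj₁ refl) = trans (Graph.adj-sym (H v) b a) a≁b
    newcomers-nonadjacent (inj₂ refl) (inj₂ refl) = Graph.adj-irrefl (H v) b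

    ∈T⁻ : ∀ {z} → z ∈ T → (z ∈ S × z ≢ base v) ⊎ Σ (Fin (m v)) λ c → Newcomer c × z ≡ leaf v c
    ∈T⁻ z∈T with x∈p∪q⁻ (S - base v) _ z∈T
    ... | inj₁ z∈S-v = inj₁ (p─q⊆p S ⁅ base v ⁆ z∈S-v , x∈p-y⇒x≢y z∈S-v)
    ... | inj₂ z∈ab with x∈p∪q⁻ ⁅ leaf v a ⁆ ⁅ leaf v b ⁆ z∈ab
    ...   | inj₁ z∈a = inj₂ (a , inj₁ refl , x∈⁅y⁆⇒x≡y _ z∈a)
    ...   | inj₂ z∈b = inj₂ (b , inj₂ refl , x∈⁅y⁆⇒x≡y _ z∈b)

    T-independent : Independent (corona G H) T
    T-independent y z y∈T z∈T with ∈T⁻ y∈T | ∈T⁻ z∈T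
    ... | inj₁ (y∈S , _) | inj₁ (z∈S , _) = indep y z y∈S z∈S
    ... | inj₁ (y∈S , y≢) | inj₂ (c , _ , refl) =
      adj-crossFiber (λ same → fiber≢v y∈S y≢ (trans same (fiber-leaf v c))) (inj₂ (v , c , refl))
    ... | inj₂ (c , _ , refl) | inj₁ (z∈S , z≢) =
      adj-crossFiber (λ same → fiber≢v z∈S z≢ (trans (sym same) (fiber-leaf v c))) (inj₁ (v , c , refl))
    ... | inj₂ (c , c-new , refl) | inj₂ (d , d-new , refl) =
      trans (adj-leaf-leaf v c d) (newcomers-nonadjacent c-new d-new)

    a∈T : leaf v a ∈ T
    a∈T = x∈p∪q⁺ (inj₂ (x∈p∪q⁺ (inj₁ (x∈⁅x⁆ _))))

    b∈T : leaf v b ∈ T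
    b∈T = x∈p∪q⁺ (inj₂ (x∈p∪q⁺ (inj₂ (x∈⁅x⁆ _))))

    swap : Vertex → Vertex
    swap z with z ≟ base v
    ... | yes _ = leaf v a
    ... | no  _ = z

    swap-into : ∀ {z} → z ∈ S → swap z ∈ T - leaf v b
    swap-into {z} z∈S with z ≟ base v
    ... | yes _  = x∈p∧x≢y⇒x∈p-y a∈T (a≢b ∘ leaf-injective v)
    ... | no  z≢ = x∈p∧x≢y⇒x∈p-y (x∈p∪q⁺ (inj₁ (x∈p∧x≢y⇒x∈p-y z∈S z≢))) λ { refl → leaf∉S b z∈S }

    swap-injective : ∀ {y z} → y ∈ S → z ∈ S → swap y ≡ swap z → y ≡ z
    swap-injective {y} {z} y∈S z∈S eq with y ≟ base v | z ≟ base v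
    ... | yes y≡ | yes z≡ = trans y≡ (sym z≡)
    ... | yes _  | no  _  = contradiction (subst (_∈ S) (sym eq) z∈S) (leaf∉S a)
    ... | no  _  | yes _  = contradiction (subst (_∈ S) eq y∈S) (leaf∉S a)
    ... | no  _  | no  _  = eq

    ∣S∣<∣T∣ : ∣ S ∣ < ∣ T ∣
    ∣S∣<∣T∣ = ≤-<-trans (injection⇒∣p∣≤∣q∣ swap swap-into swap-injective) (x∈p⇒∣p-x∣<∣p∣ b∈T)

  αSet∋base⇒Complete : ∀ {S v} → IsαSet (corona G H) S → base v ∈ S → Complete (raw (H v))
  αSet∋base⇒Complete {v = v} (indep , maximum) base∈S a b a≢b with adj (raw (H v)) a b in a~b
  ... | true  = refl
  ... | false = contradiction (maximum T T-independent) (<⇒≱ ∣S∣<∣T∣)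
    where open Exchange indep base∈S a≢b a~b

  αExcellent⇒complete : αExcellent (corona G H) → ∀ v → Complete (raw (H v))
  αExcellent⇒complete excellent v with excellent (base v)
  ... | S , αSet , base∈S = αSet∋base⇒Complete αSet base∈S

corona-αExcellent⇔complete : (G : Graph) (H : Fin (n (raw G)) → Graph) →
                             (∀ v → Nonempty (raw (H v))) →
                             αExcellent (corona G H) ⇔ (∀ v → Complete (raw (H v)))
corona-αExcellent⇔complete G H nonempty = mk⇔ αExcellent⇒complete (complete⇒αExcellent nonempty)
  where open Corona G H

K₁-complete : Complete (raw K₁)
K₁-complete zero zero 0≢0 = contradiction refl 0≢0

mainTheorem2 : ((G : Graph) (H : Fin (n (raw G)) → Graph) →
                  (∀ v → Nonempty (raw (H v))) →
                  (αExcellent (corona G H) ⇔ (∀ v → Complete (raw (H v)))))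
               × ((G : Graph) → αExcellent (corona G (λ _ → K₁)))
mainTheorem2 = corona-αExcellent⇔complete , λ G →
  Equivalence.from (corona-αExcellent⇔complete G (λ _ → K₁) (λ _ → s≤s z≤n)) (λ _ → K₁-complete)
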